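{- Let $n\ge3$. Let $a_{n-1}$ and $b_{n-1}$ be the numbers of matrices in $\mathcal{T}(1,1,0^{n-3})$ with diagonal product $3$ and $4$ respectively (these are the only possible diagonal products, so $A_{n-1}((1,1,0^{n-3}),q)=a_{n-1}q^3+b_{n-1}q^4$). Then $$A_n((1,1,0^{n-2}),q)=(2a_{n-1}+b_{n-1})q^3+(a_{n-1}+3b_{n-1})q^4.$$
   Context: Let $U_m$ be the set of $m\times m$ upper-triangular matrices with nonnegative integer entries. For $A=(a_{i,j})\in U_m$, the $k$-th hook sum is $h_k=(a_{k,k}+\cdots+a_{k,m})-(a_{1,k}+\cdots+a_{k-1,k})$. For $\beta\in\mathbb{Z}_{\ge0}^m$, $\mathcal{T}(\beta)$ is the set of $A\in U_m$ with $(h_1,\ldots,h_m)=\beta$; $(1,1,0^{j})$ denotes the vector with two $1$'s followed by $j$ zeros. The diagonal product is $\mathrm{dpro}(A)=\prod_{i=1}^m(a_{ii}+1)$, and $A_m(\beta,q)=\sum_{A\in\mathcal{T}(\beta)}q^{\mathrm{dpro}(A)}$. -}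

module Defs where

open import Data.Nat using (ℕ; zero; suc; _≤_; _<_; _+_; _*_)
open import Data.Nat.Properties using (_≤?_; _<?_)
open import Data.Integer using (ℤ; +_; _-_)
open import Data.Fin using (Fin; zero; suc; toℕ)
open import Data.Vec using (Vec; []; _∷_; lookup; tabulate; sum; foldr; map; replicate)
open import Data.Product using (Σ; _×_; _,_)
open import Data.Unit using (⊤; tt)
open import Relation.Nullary.Decidable using (does)
open import Data.Bool using (if_then_else_)
open import Relation.Binary.PropositionalEquality using (_≡_)

-- U m : m×m upper-triangular matrices with entries in ℕ.
-- Represented by their first row (length m) followed by the
-- lower-right (m-1)×(m-1) upper-triangular block; entries below
-- the diagonal are (implicitly) 0.
U : ℕ → Set
U zero    = ⊤
U (suc m) = Vec ℕ (suc m) × U m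

-- entry A i j = a_{i,j}  (0-indexed); 0 below the diagonal
entry : ∀ {m} → U m → Fin m → Fin m → ℕ
entry {suc m} (r , B) zero    j       = lookup r j
entry {suc m} (r , B) (suc i) zero    = 0
entry {suc m} (r , B) (suc i) (suc j) = entry B i j

Σfin : ∀ {m} → (Fin m → ℕ) → ℕ
Σfin f = sum (tabulate f)

hook : ∀ {m} → U m → Fin m → ℤ
hook A k =
  (+ Σfin (λ j → if does (toℕ k ≤? toℕ j) then entry A k j else 0))
  - (+ Σfin (λ i → if does (toℕ i <? toℕ k) then entry A i k else 0))

hooks : ∀ {m} → U m → Vec ℤ m
hooks A = tabulate (hook A)

dpro : ∀ {m} → U m → ℕ
dpro A = foldr (λ _ → ℕ) _*_ 1 (tabulate (λ i → suc (entry A i i)))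

TD : (m : ℕ) → Vec ℕ m → ℕ → Set
TD m β d = Σ (U m) (λ A → (hooks A ≡ map +_ β) × (dpro A ≡ d))

β110 : (j : ℕ) → Vec ℕ (2 + j)
β110 j = 1 ∷ 1 ∷ replicate j 0

coeff34 : ℕ → ℕ → ℕ → ℕ
coeff34 c3 c4 3 = c3
coeff34 c3 c4 4 = c4
coeff34 c3 c4 _ = 0

module Submission where

-- Removing the last column (c, x) of an n×n matrix in T(γ ∷ʳ b) raises the hooks of the first
-- n-1 rows by c, exactly as adding c to the diagonal would; the last hook forces x = b + Σc.
-- Hence T(γ ∷ʳ b) is in bijection with pairs (A, c) where A ∈ T(γ) and c ≤ diag A, and the
-- diagonal product becomes ∏(1 + Aᵢᵢ - cᵢ) · (1 + b + Σc)  (lastColumn).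
-- For γ = (1,1,0^j) the trace of A equals Σγ = 2, so diag A is 2·eᵢ (product 3) or eᵢ + eⱼ
-- (product 4); enumerating c gives weights 3,4,3 resp. 4,4,4,3, i.e. 2q³ + q⁴ resp. q³ + 3q⁴.

open import Defs
open import Data.Bool using (if_then_else_)
open import Data.Empty using (⊥-elim)
open import Data.Fin using (Fin; zero; suc; toℕ)
open import Data.Fin.Properties using (+↔⊎; *↔×)
open import Data.Integer as ℤ using (ℤ; +_)
import Data.Integer.Properties as ℤP
open import Data.Integer.Tactic.RingSolver using (solve-∀)
open import Data.Nat using (ℕ; zero; suc; _+_; _*_; _∸_; _≤_; z≤n; s≤s; _≟_)
open import Data.Nat.Base using (_≤ᵇ_; _<ᵇ_)
open import Data.Nat.Properties using (≤-irrelevant; suc-injective; +-comm; +-assoc; +-identityʳ; *-assoc; *-identityˡ; *-identityʳ; m+n∸n≡m; m∸n+n≡m; m≤n+m)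
import Data.Nat.Tactic.RingSolver as ℕ-Solver
open import Data.Product using (Σ; _×_; _,_; proj₁; proj₂)
open import Data.Product.Function.Dependent.Propositional using (Σ-↔)
open import Data.Product.Function.NonDependent.Propositional using (_×-↔_)
open import Data.Sum as Sum using (_⊎_; inj₁; inj₂)
open import Data.Sum.Function.Propositional using (_⊎-↔_)
open import Data.Unit using (⊤; tt)
open import Data.Vec using (Vec; []; _∷_; _∷ʳ_; lookup; sum; map; zipWith; replicate; init; last; initLast)
open import Data.Vec.Properties using (tabulate-cong; tabulate∘lookup; lookup∘tabulate; tabulate-∘; lookup-map; lookup-zipWith; init-∷ʳ; last-∷ʳ)
open import Data.Vec.Relation.Binary.Pointwise.Inductive using (Pointwise; []; _∷_)
open import Function.Bundles using (_↔_; _⇔_; mk↔ₛ′; mk⇔; Equivalence; Inverse)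
open import Function.Properties.Equivalence using () renaming (trans to ⇔-trans)
open import Function.Properties.Inverse using (↔-refl; ↔-sym; ↔-trans)
open import Function.Related.Propositional using (module EquationalReasoning)
open import Function.Related.TypeIsomorphisms using (Σ-assoc; Σ-distribʳ-⊎)
open import Relation.Binary.PropositionalEquality
open import Relation.Nullary using (Irrelevant; yes; no)
open import Axiom.UniquenessOfIdentityProofs.WithK using (uip)

open Equivalence using (to; from)

×-irrelevant : {P Q : Set} → Irrelevant P → Irrelevant Q → Irrelevant (P × Q)
×-irrelevant irrP irrQ (p , q) (p' , q') = cong₂ _,_ (irrP p p') (irrQ q q')

Σ-≡ : {A : Set} {P : A → Set} → (∀ a → Irrelevant (P a)) →
      {a a' : A} → a ≡ a' → (p : P a) (q : P a') → (a , p) ≡ (a' , q)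
Σ-≡ irr refl p q = cong (_ ,_) (irr _ p q)

Σ-reindex : {A B : Set} {P : A → Set} {Q : B → Set}
  → (∀ a → Irrelevant (P a)) → (∀ b → Irrelevant (Q b))
  → (f : A → B) (g : B → A)
  → (∀ a → P a → Q (f a)) → (∀ b → Q b → P (g b))
  → (∀ a → P a → g (f a) ≡ a) → (∀ b → Q b → f (g b) ≡ b)
  → Σ A P ↔ Σ B Q
Σ-reindex irrP irrQ f g fP gQ gf fg =
  mk↔ₛ′ (λ (a , p) → f a , fP a p) (λ (b , q) → g b , gQ b q)
        (λ (b , q) → Σ-≡ irrQ (fg b q) _ q) (λ (a , p) → Σ-≡ irrP (gf a p) _ p)

Σ-split : {X : Set} (P : X → Set) (w : X → ℕ) {u v : ℕ} → u ≢ v → (∀ x → P x → w x ≡ u ⊎ w x ≡ v) →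
          Σ X P ↔ (Σ X (λ x → P x × w x ≡ u) ⊎ Σ X (λ x → P x × w x ≡ v))
Σ-split {X} P w {u} {v} u≢v twoValued = mk↔ₛ′ forward backward forward∘backward backward∘forward
  where
  notU⇒v : ∀ x → P x → w x ≢ u → w x ≡ v
  notU⇒v x p w≢u with twoValued x p
  ... | inj₁ w≡u = ⊥-elim (w≢u w≡u)
  ... | inj₂ w≡v = w≡v
  forward : Σ X P → Σ X (λ x → P x × w x ≡ u) ⊎ Σ X (λ x → P x × w x ≡ v)
  forward (x , p) with w x ≟ u
  ... | yes w≡u = inj₁ (x , p , w≡u)
  ... | no  w≢u = inj₂ (x , p , notU⇒v x p w≢u)
  backward : Σ X (λ x → P x × w x ≡ u) ⊎ Σ X (λ x → P x × w x ≡ v) → Σ X P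
  backward (inj₁ (x , p , _)) = x , p
  backward (inj₂ (x , p , _)) = x , p
  forward∘backward : ∀ y → forward (backward y) ≡ y
  forward∘backward (inj₁ (x , p , w≡u)) with w x ≟ u
  ... | yes _   = cong (λ e → inj₁ (x , p , e)) (uip _ _)
  ... | no  w≢u = ⊥-elim (w≢u w≡u)
  forward∘backward (inj₂ (x , p , w≡v)) with w x ≟ u
  ... | yes w≡u = ⊥-elim (u≢v (trans (sym w≡u) w≡v))
  ... | no  _   = cong (λ e → inj₂ (x , p , e)) (uip _ _)
  backward∘forward : ∀ y → backward (forward y) ≡ y
  backward∘forward (x , p) with w x ≟ u
  ... | yes _ = refl
  ... | no  _ = refl

Σ-split-count : {X : Set} (P F : X → Set) (w : X → ℕ) {u v k l : ℕ} → u ≢ v →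
  (∀ x → P x → (w x ≡ u × F x ↔ Fin k) ⊎ (w x ≡ v × F x ↔ Fin l)) →
  Σ X (λ x → P x × F x) ↔ ((Σ X (λ x → P x × w x ≡ u) × Fin k) ⊎ (Σ X (λ x → P x × w x ≡ v) × Fin l))
Σ-split-count {X} P F w {u} {v} {k} {l} u≢v cases = begin
  Σ X (λ x → P x × F x)                                    ↔⟨ ↔-sym Σ-assoc ⟩
  Σ (Σ X P) (λ y → F (proj₁ y))                             ↔⟨ ↔-sym (Σ-↔ (↔-sym split) ↔-refl) ⟩
  Σ (Su ⊎ Sv) (λ y → F (proj₁ (Inverse.from split y)))      ↔⟨ Σ-distribʳ-⊎ ⟩
  (Σ Su (λ y → F (proj₁ y)) ⊎ Σ Sv (λ y → F (proj₁ y)))    ↔⟨ Σ-↔ ↔-refl (λ {y} → sizeU y) ⊎-↔ Σ-↔ ↔-refl (λ {y} → sizeV y) ⟩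
  ((Su × Fin k) ⊎ (Sv × Fin l))                            ∎
  where
  open EquationalReasoning
  Su : Set
  Su = Σ X (λ x → P x × w x ≡ u)
  Sv : Set
  Sv = Σ X (λ x → P x × w x ≡ v)
  split : Σ X P ↔ (Su ⊎ Sv)
  split = Σ-split P w u≢v (λ x p → Sum.map proj₁ proj₁ (cases x p))
  sizeU : (y : Su) → F (proj₁ y) ↔ Fin k
  sizeU (x , p , w≡u) with cases x p
  ... | inj₁ (_ , size) = size
  ... | inj₂ (w≡v , _) = ⊥-elim (u≢v (trans (sym w≡u) w≡v))
  sizeV : (y : Sv) → F (proj₁ y) ↔ Fin l
  sizeV (x , p , w≡v) with cases x p
  ... | inj₁ (w≡u , _) = ⊥-elim (u≢v (trans (sym w≡u) w≡v))
  ... | inj₂ (_ , size) = size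

δ : ℕ → ℕ → ℕ
δ a d with a ≟ d
... | yes _ = 1
... | no  _ = 0

≡↔δ : ∀ a d → (a ≡ d) ↔ Fin (δ a d)
≡↔δ a d with a ≟ d
... | yes a≡d = mk↔ₛ′ (λ _ → zero) (λ _ → a≡d) (λ { zero → refl }) (λ _ → uip _ _)
... | no  a≢d = mk↔ₛ′ (λ e → ⊥-elim (a≢d e)) (λ ()) (λ ()) (λ e → ⊥-elim (a≢d e))

Fin-cong : ∀ {m n} → m ≡ n → Fin m ↔ Fin n
Fin-cong refl = ↔-refl

Σ≤ : ℕ → (ℕ → ℕ) → ℕ
Σ≤ zero    g = g 0
Σ≤ (suc x) g = g 0 + Σ≤ x (λ z → g (suc z))

Σ≤↔ : ∀ x (F : ℕ → Set) (g : ℕ → ℕ) → (∀ z → F z ↔ Fin (g z)) →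
      Σ ℕ (λ z → z ≤ x × F z) ↔ Fin (Σ≤ x g)
Σ≤↔ zero F g F↔ = begin
  Σ ℕ (λ z → z ≤ 0 × F z)   ↔⟨ onlyZero ⟩
  F 0                        ↔⟨ F↔ 0 ⟩
  Fin (g 0)                  ∎
  where
  open EquationalReasoning
  onlyZero : Σ ℕ (λ z → z ≤ 0 × F z) ↔ F 0
  onlyZero = mk↔ₛ′ (λ { (.0 , z≤n , y) → y }) (λ y → 0 , z≤n , y)
                   (λ _ → refl) (λ { (.0 , z≤n , y) → refl })
Σ≤↔ (suc x) F g F↔ = begin
  Σ ℕ (λ z → z ≤ suc x × F z)                          ↔⟨ peel ⟩
  (F 0 ⊎ Σ ℕ (λ z → z ≤ x × F (suc z)))                ↔⟨ F↔ 0 ⊎-↔ Σ≤↔ x (λ z → F (suc z)) (λ z → g (suc z)) (λ z → F↔ (suc z)) ⟩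
  (Fin (g 0) ⊎ Fin (Σ≤ x (λ z → g (suc z))))           ↔⟨ ↔-sym +↔⊎ ⟩
  Fin (Σ≤ (suc x) g)                                   ∎
  where
  open EquationalReasoning
  peel : Σ ℕ (λ z → z ≤ suc x × F z) ↔ (F 0 ⊎ Σ ℕ (λ z → z ≤ x × F (suc z)))
  peel = mk↔ₛ′ (λ { (.0 , z≤n , y) → inj₁ y ; (suc z , s≤s z≤x , y) → inj₂ (z , z≤x , y) })
               (λ { (inj₁ y) → 0 , z≤n , y ; (inj₂ (z , z≤x , y)) → suc z , s≤s z≤x , y })
               (λ { (inj₁ _) → refl ; (inj₂ _) → refl })
               (λ { (.0 , z≤n , _) → refl ; (suc z , s≤s _ , _) → refl })

sum-∷ʳ : ∀ {m} (v : Vec ℕ m) x → sum (v ∷ʳ x) ≡ sum v + x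
sum-∷ʳ []      x = +-identityʳ x
sum-∷ʳ (y ∷ v) x rewrite sum-∷ʳ v x = sym (+-assoc y (sum v) x)

sum-zipWith-+ : ∀ {m} (u v : Vec ℕ m) → sum (zipWith _+_ u v) ≡ sum u + sum v
sum-zipWith-+ []      []      = refl
sum-zipWith-+ (x ∷ u) (y ∷ v) rewrite sum-zipWith-+ u v = ring x y (sum u) (sum v)
  where
  ring : ∀ x y a b → x + y + (a + b) ≡ x + a + (y + b)
  ring = ℕ-Solver.solve-∀

zipWith-∷ʳ : ∀ {A B C : Set} {m} (f : A → B → C) (u : Vec A m) (v : Vec B m) a b → zipWith f (u ∷ʳ a) (v ∷ʳ b) ≡ zipWith f u v ∷ʳ f a b
zipWith-∷ʳ f []      []      a b = refl
zipWith-∷ʳ f (x ∷ u) (y ∷ v) a b = cong (f x y ∷_) (zipWith-∷ʳ f u v a b)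

prodSuc : ∀ {m} → Vec ℕ m → ℕ
prodSuc []      = 1
prodSuc (x ∷ v) = suc x * prodSuc v

prodSuc-∷ʳ : ∀ {m} (v : Vec ℕ m) x → prodSuc (v ∷ʳ x) ≡ prodSuc v * suc x
prodSuc-∷ʳ []      x = trans (*-identityʳ (suc x)) (sym (*-identityˡ (suc x)))
prodSuc-∷ʳ (y ∷ v) x rewrite prodSuc-∷ʳ v x = sym (*-assoc (suc y) (prodSuc v) (suc x))

_≤*_ : ∀ {m} → Vec ℕ m → Vec ℕ m → Set
_≤*_ = Pointwise _≤_

≤*-irrelevant : ∀ {m} {c E : Vec ℕ m} → Irrelevant (c ≤* E)
≤*-irrelevant []       []       = refl
≤*-irrelevant (p ∷ ps) (q ∷ qs) = cong₂ _∷_ (≤-irrelevant p q) (≤*-irrelevant ps qs)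

≤*-+ : ∀ {m} (D c : Vec ℕ m) → c ≤* zipWith _+_ D c
≤*-+ []      []       = []
≤*-+ (x ∷ D) (c ∷ cs) = m≤n+m c x ∷ ≤*-+ D cs

+-∸-vec : ∀ {m} (D c : Vec ℕ m) → zipWith _∸_ (zipWith _+_ D c) c ≡ D
+-∸-vec []      []       = refl
+-∸-vec (x ∷ D) (c ∷ cs) = cong₂ _∷_ (m+n∸n≡m x c) (+-∸-vec D cs)

Σfin-zero : ∀ m → Σfin {m} (λ _ → 0) ≡ 0
Σfin-zero zero    = refl
Σfin-zero (suc m) = Σfin-zero m

<ᵇ-suc : ∀ a b → (a <ᵇ suc b) ≡ (a ≤ᵇ b)
<ᵇ-suc zero    b = refl
<ᵇ-suc (suc a) b = refl

subtract-sum : ∀ R C c → + R ℤ.- + (c + C) ≡ (+ R ℤ.- + C) ℤ.- + c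
subtract-sum R C c rewrite ℤP.pos-+ c C = ring (+ R) (+ C) (+ c)
  where
  ring : ∀ (x y z : ℤ) → x ℤ.- (z ℤ.+ y) ≡ (x ℤ.- y) ℤ.- z
  ring = solve-∀

-- The hook of the corner entry is the sum of the first row (nothing lies above it).
hook-head : ∀ {m} (r : Vec ℕ (suc m)) (B : U m) → hook (r , B) zero ≡ + sum r
hook-head {m} (x ∷ o) B rewrite tabulate∘lookup o | Σfin-zero m = ℤP.+-identityʳ (+ sum (x ∷ o))

-- For a later row, the first-row entry above the diagonal joins the column sum.
hook-tail : ∀ {m} (r : Vec ℕ (suc m)) (B : U m) (k : Fin m) →
            hook (r , B) (suc k) ≡ hook B k ℤ.- + lookup r (suc k)
hook-tail r B k
  rewrite tabulate-cong {f = λ j → if (toℕ k <ᵇ suc (toℕ j)) then entry B k j else 0}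
                        {g = λ j → if (toℕ k ≤ᵇ toℕ j) then entry B k j else 0}
                        (λ j → cong (λ t → if t then entry B k j else 0) (<ᵇ-suc (toℕ k) (toℕ j)))
  = subtract-sum _ _ (lookup r (suc k))

shift⇔ : ∀ (h : ℤ) b c → (h ℤ.- + c ≡ + b) ⇔ (h ≡ + (b + c))
shift⇔ h b c = mk⇔ forward backward
  where
  forward : h ℤ.- + c ≡ + b → h ≡ + (b + c)
  forward e = begin
    h                     ≡⟨ ring₁ h (+ c) ⟩
    (h ℤ.- + c) ℤ.+ + c   ≡⟨ cong (ℤ._+ + c) e ⟩
    + b ℤ.+ + c           ≡⟨ ℤP.pos-+ b c ⟨
    + (b + c)             ∎
    where
    open ≡-Reasoning
    ring₁ : ∀ (x y : ℤ) → x ≡ (x ℤ.- y) ℤ.+ y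
    ring₁ = solve-∀
  backward : h ≡ + (b + c) → h ℤ.- + c ≡ + b
  backward refl rewrite ℤP.pos-+ b c = ring₂ (+ b) (+ c)
    where
    ring₂ : ∀ (x y : ℤ) → (x ℤ.+ y) ℤ.- y ≡ x
    ring₂ = solve-∀

-- The hook conditions in recursive form: the first row sums to b, and the block below it
-- satisfies the hook conditions for bs shifted by the off-diagonal entries o of the first row.
HasHooks : ∀ {m} → U m → Vec ℕ m → Set
HasHooks {zero}  tt            []       = ⊤
HasHooks {suc m} ((x ∷ o) , B) (b ∷ bs) = x + sum o ≡ b × HasHooks B (zipWith _+_ bs o)

HasHooks-irrelevant : ∀ {m} (A : U m) γ → Irrelevant (HasHooks A γ)
HasHooks-irrelevant {zero}  tt            []       = λ _ _ → refl
HasHooks-irrelevant {suc m} ((x ∷ o) , B) (b ∷ bs) = ×-irrelevant uip (HasHooks-irrelevant B _)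

HooksAt : ∀ {m} → U m → Vec ℕ m → Set
HooksAt A γ = ∀ k → hook A k ≡ + lookup γ k

hooks⇔HooksAt : ∀ {m} (A : U m) γ → (hooks A ≡ map +_ γ) ⇔ HooksAt A γ
hooks⇔HooksAt A γ = mk⇔
  (λ e k → trans (sym (lookup∘tabulate (hook A) k)) (trans (cong (λ v → lookup v k) e) (lookup-map k +_ γ)))
  (λ h → trans (tabulate-cong h) (trans (tabulate-∘ +_ (lookup γ)) (cong (λ v → map +_ v) (tabulate∘lookup γ))))

HooksAt⇔HasHooks : ∀ {m} (A : U m) γ → HooksAt A γ ⇔ HasHooks A γ
HooksAt⇔HasHooks {zero}  tt            []       = mk⇔ (λ _ → tt) (λ _ ())
HooksAt⇔HasHooks {suc m} ((x ∷ o) , B) (b ∷ bs) = mk⇔ forward backward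
  where
  r : Vec ℕ (suc m)
  r = x ∷ o
  block⇔ : HooksAt B (zipWith _+_ bs o) ⇔ HasHooks B (zipWith _+_ bs o)
  block⇔ = HooksAt⇔HasHooks B (zipWith _+_ bs o)
  row⇔ : ∀ k → (hook (r , B) (suc k) ≡ + lookup bs k) ⇔ (hook B k ≡ + lookup (zipWith _+_ bs o) k)
  row⇔ k rewrite hook-tail r B k | lookup-zipWith _+_ k bs o = shift⇔ (hook B k) (lookup bs k) (lookup o k)
  forward : HooksAt (r , B) (b ∷ bs) → HasHooks (r , B) (b ∷ bs)
  forward h = ℤP.+-injective (trans (sym (hook-head r B)) (h zero))
            , to block⇔ (λ k → to (row⇔ k) (h (suc k)))
  backward : HasHooks (r , B) (b ∷ bs) → HooksAt (r , B) (b ∷ bs)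
  backward (row , _)     zero    = trans (hook-head r B) (cong +_ row)
  backward (_   , block) (suc k) = from (row⇔ k) (from block⇔ block k)

hooks⇔HasHooks : ∀ {m} (A : U m) γ → (hooks A ≡ map +_ γ) ⇔ HasHooks A γ
hooks⇔HasHooks A γ = ⇔-trans (hooks⇔HooksAt A γ) (HooksAt⇔HasHooks A γ)

diag : ∀ {m} → U m → Vec ℕ m
diag {zero}  tt            = []
diag {suc m} ((x ∷ _) , B) = x ∷ diag B

dpro≡prodSuc-diag : ∀ {m} (A : U m) → dpro A ≡ prodSuc (diag A)
dpro≡prodSuc-diag {zero}  tt            = refl
dpro≡prodSuc-diag {suc m} ((x ∷ _) , B) = cong (suc x *_) (dpro≡prodSuc-diag B)

TDʳ : (m : ℕ) → Vec ℕ m → ℕ → Set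
TDʳ m γ d = Σ (U m) (λ A → HasHooks A γ × prodSuc (diag A) ≡ d)

TD↔TDʳ : ∀ m γ d → TD m γ d ↔ TDʳ m γ d
TD↔TDʳ m γ d = Σ-reindex (λ _ → ×-irrelevant uip uip) (λ A → ×-irrelevant (HasHooks-irrelevant A γ) uip)
  (λ A → A) (λ A → A)
  (λ A (h , e) → to (hooks⇔HasHooks A γ) h , trans (sym (dpro≡prodSuc-diag A)) e)
  (λ A (h , e) → from (hooks⇔HasHooks A γ) h , trans (dpro≡prodSuc-diag A) e)
  (λ _ _ → refl) (λ _ _ → refl)

-- The trace of a matrix equals the sum of its hooks: every off-diagonal entry is counted
-- once positively (in its row) and once negatively (in its column).
trace≡sum-hooks : ∀ {m} (A : U m) γ → HasHooks A γ → sum (diag A) ≡ sum γ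
trace≡sum-hooks {zero}  tt            []       _             = refl
trace≡sum-hooks {suc m} ((x ∷ o) , B) (b ∷ bs) (row , block) = begin
  x + sum (diag B)                 ≡⟨ cong (λ t → x + t) (trace≡sum-hooks B _ block) ⟩
  x + sum (zipWith _+_ bs o)       ≡⟨ cong (λ t → x + t) (sum-zipWith-+ bs o) ⟩
  x + (sum bs + sum o)             ≡⟨ ring x (sum bs) (sum o) ⟩
  x + sum o + sum bs               ≡⟨ cong (_+ sum bs) row ⟩
  b + sum bs                       ∎
  where
  open ≡-Reasoning
  ring : ∀ x a c → x + (a + c) ≡ x + c + a
  ring = ℕ-Solver.solve-∀

-- Appending a last column (c , x) to a matrix, x being the new diagonal entry, and its inverse.
addCol : ∀ {m} → U m → Vec ℕ m → ℕ → U (suc m)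
addCol {zero}  tt      []       x = (x ∷ []) , tt
addCol {suc m} (r , B) (c ∷ cs) x = (r ∷ʳ c) , addCol B cs x

removeCol : ∀ {m} → U (suc m) → U m × Vec ℕ m × ℕ
removeCol {zero}  ((x ∷ []) , tt) = tt , [] , x
removeCol {suc m} (r , B) =
  let (B′ , cs , x) = removeCol B in (init r , B′) , last r ∷ cs , x

removeCol-addCol : ∀ {m} (A : U m) c x → removeCol (addCol A c x) ≡ (A , c , x)
removeCol-addCol {zero}  tt      []       x = refl
removeCol-addCol {suc m} (r , B) (c ∷ cs) x
  rewrite removeCol-addCol B cs x | init-∷ʳ c r | last-∷ʳ c r = refl

addCol-removeCol : ∀ {m} (A : U (suc m)) → let (B , c , x) = removeCol A in addCol B c x ≡ A
addCol-removeCol {zero}  ((x ∷ []) , tt) = refl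
addCol-removeCol {suc m} (r , B) = cong₂ _,_ (sym (proj₂ (proj₂ (initLast r)))) (addCol-removeCol B)

column↔ : ∀ {m} → (U m × Vec ℕ m × ℕ) ↔ U (suc m)
column↔ = mk↔ₛ′ (λ (A , c , x) → addCol A c x) removeCol addCol-removeCol
                 (λ (A , c , x) → removeCol-addCol A c x)

diag-addCol : ∀ {m} (A : U m) c x → diag (addCol A c x) ≡ diag A ∷ʳ x
diag-addCol {zero}  tt            []       x = refl
diag-addCol {suc m} ((y ∷ o) , B) (c ∷ cs) x = cong (y ∷_) (diag-addCol B cs x)

updateDiag : ∀ {m} → (ℕ → ℕ → ℕ) → U m → Vec ℕ m → U m
updateDiag {zero}  f tt            []       = tt
updateDiag {suc m} f ((x ∷ o) , B) (c ∷ cs) = (f x c ∷ o) , updateDiag f B cs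

diag-updateDiag : ∀ {m} f (A : U m) c → diag (updateDiag f A c) ≡ zipWith f (diag A) c
diag-updateDiag {zero}  f tt            []       = refl
diag-updateDiag {suc m} f ((x ∷ o) , B) (c ∷ cs) = cong (f x c ∷_) (diag-updateDiag f B cs)

+-∸-diag : ∀ {m} (A : U m) c → updateDiag _∸_ (updateDiag _+_ A c) c ≡ A
+-∸-diag {zero}  tt            []       = refl
+-∸-diag {suc m} ((x ∷ o) , B) (c ∷ cs) = cong₂ (λ y B′ → (y ∷ o) , B′) (m+n∸n≡m x c) (+-∸-diag B cs)

∸-+-diag : ∀ {m} (A : U m) c → c ≤* diag A → updateDiag _+_ (updateDiag _∸_ A c) c ≡ A
∸-+-diag {zero}  tt            []       []       = refl
∸-+-diag {suc m} ((x ∷ o) , B) (c ∷ cs) (c≤x ∷ cs≤) =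
  cong₂ (λ y B′ → (y ∷ o) , B′) (m∸n+n≡m c≤x) (∸-+-diag B cs cs≤)

-- The key observation: appending a last column (c , x) raises the hooks of the first m rows by c,
-- exactly as adding c to the diagonal does; the new last hook is x - Σ c.
HasHooks-addCol : ∀ {m} (A : U m) c x γ b →
  HasHooks (addCol A c x) (γ ∷ʳ b) ⇔ (HasHooks (updateDiag _+_ A c) γ × x ≡ b + sum c)
HasHooks-addCol {zero} tt [] x [] b = mk⇔
  (λ (e , _) → tt , trans (sym (+-identityʳ x)) (trans e (sym (+-identityʳ b))))
  (λ (_ , e) → trans (+-identityʳ x) (trans e (+-identityʳ b)) , tt)
HasHooks-addCol {suc m} ((y ∷ o) , B) (c ∷ cs) x (b₀ ∷ bs) b = mk⇔ forward backward
  where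
  block⇔ : HasHooks (addCol B cs x) (zipWith _+_ bs o ∷ʳ (b + c))
         ⇔ (HasHooks (updateDiag _+_ B cs) (zipWith _+_ bs o) × x ≡ b + c + sum cs)
  block⇔ = HasHooks-addCol B cs x (zipWith _+_ bs o) (b + c)
  firstRow : y + sum (o ∷ʳ c) ≡ y + c + sum o
  firstRow = trans (cong (λ t → y + t) (sum-∷ʳ o c)) (ring y (sum o) c)
    where
    ring : ∀ y s c → y + (s + c) ≡ y + c + s
    ring = ℕ-Solver.solve-∀
  shifts : zipWith _+_ (bs ∷ʳ b) (o ∷ʳ c) ≡ zipWith _+_ bs o ∷ʳ (b + c)
  shifts = zipWith-∷ʳ _+_ bs o b c
  forward : HasHooks (addCol ((y ∷ o) , B) (c ∷ cs) x) ((b₀ ∷ bs) ∷ʳ b) →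
            HasHooks (updateDiag _+_ ((y ∷ o) , B) (c ∷ cs)) (b₀ ∷ bs) × x ≡ b + sum (c ∷ cs)
  forward (row , block) =
    let (block′ , x≡) = to block⇔ (subst (HasHooks (addCol B cs x)) shifts block)
    in (trans (sym firstRow) row , block′) , trans x≡ (+-assoc b c (sum cs))
  backward : HasHooks (updateDiag _+_ ((y ∷ o) , B) (c ∷ cs)) (b₀ ∷ bs) × x ≡ b + sum (c ∷ cs) →
             HasHooks (addCol ((y ∷ o) , B) (c ∷ cs) x) ((b₀ ∷ bs) ∷ʳ b)
  backward ((row , block′) , x≡) =
    trans firstRow row ,
    subst (HasHooks (addCol B cs x)) (sym shifts) (from block⇔ (block′ , trans x≡ (sym (+-assoc b c (sum cs)))))

-- For p = 1 the weight is the diagonal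
-- product of the enlarged matrix once c has been taken off the diagonal again.
Columns : ∀ {m} (p s : ℕ) → Vec ℕ m → ℕ → Set
Columns {m} p s E d = Σ (Vec ℕ m) (λ c → c ≤* E × p * prodSuc (zipWith _∸_ E c) * suc (s + sum c) ≡ d)

-- (The factor 1 is the multiplier p of Columns.)
prodSuc-diag-addCol : ∀ {m} (A : U m) c x → prodSuc (diag (addCol A c x)) ≡ 1 * prodSuc (diag A) * suc x
prodSuc-diag-addCol A c x = begin
  prodSuc (diag (addCol A c x))   ≡⟨ cong prodSuc (diag-addCol A c x) ⟩
  prodSuc (diag A ∷ʳ x)           ≡⟨ prodSuc-∷ʳ (diag A) x ⟩
  prodSuc (diag A) * suc x        ≡⟨ cong (_* suc x) (*-identityˡ (prodSuc (diag A))) ⟨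
  1 * prodSuc (diag A) * suc x    ∎
  where open ≡-Reasoning

-- Removing the last column (c , x) of a matrix in T(γ ∷ʳ b) and adding c to the diagonal of the
-- remaining matrix gives a matrix in T(γ); the corner entry is forced to be x = b + Σ c.
lastColumn : ∀ {m} (γ : Vec ℕ m) b d →
  TDʳ (suc m) (γ ∷ʳ b) d ↔ Σ (U m) (λ A → HasHooks A γ × Columns 1 b (diag A) d)
lastColumn {m} γ b d = begin
  TDʳ (suc m) (γ ∷ʳ b) d                                       ↔⟨ ↔-sym (Σ-↔ column↔ ↔-refl) ⟩
  Σ (U m × Vec ℕ m × ℕ) Columned                               ↔⟨ Σ-reindex irrC irrD f g fP gQ gf fg ⟩
  Σ (U m × Vec ℕ m) Diagonalised                               ↔⟨ regroup ⟩
  Σ (U m) (λ A → HasHooks A γ × Columns 1 b (diag A) d)          ∎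
  where
  open EquationalReasoning
  Columned : U m × Vec ℕ m × ℕ → Set
  Columned (A , c , x) = HasHooks (addCol A c x) (γ ∷ʳ b) × prodSuc (diag (addCol A c x)) ≡ d
  Diagonalised : U m × Vec ℕ m → Set
  Diagonalised (A , c) =
    HasHooks A γ × c ≤* diag A × 1 * prodSuc (zipWith _∸_ (diag A) c) * suc (b + sum c) ≡ d
  irrC : ∀ t → Irrelevant (Columned t)
  irrC (A , c , x) = ×-irrelevant (HasHooks-irrelevant _ _) uip
  irrD : ∀ t → Irrelevant (Diagonalised t)
  irrD (A , c) = ×-irrelevant (HasHooks-irrelevant A γ) (×-irrelevant ≤*-irrelevant uip)
  f : U m × Vec ℕ m × ℕ → U m × Vec ℕ m
  f (A , c , x) = updateDiag _+_ A c , c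
  g : U m × Vec ℕ m → U m × Vec ℕ m × ℕ
  g (A , c) = updateDiag _∸_ A c , c , b + sum c
  fP : ∀ t → Columned t → Diagonalised (f t)
  fP (A , c , x) (h , e) =
    let (h′ , x≡) = to (HasHooks-addCol A c x γ b) h in
    h′ , subst (c ≤*_) (sym (diag-updateDiag _+_ A c)) (≤*-+ (diag A) c) ,
    trans (cong (λ D → 1 * prodSuc D * suc (b + sum c)) restored)
          (trans (cong (λ t → 1 * prodSuc (diag A) * suc t) (sym x≡)) (trans (sym (prodSuc-diag-addCol A c x)) e))
    where
    restored : zipWith _∸_ (diag (updateDiag _+_ A c)) c ≡ diag A
    restored = trans (cong (λ D → zipWith _∸_ D c) (diag-updateDiag _+_ A c)) (+-∸-vec (diag A) c)
  gQ : ∀ t → Diagonalised t → Columned (g t)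
  gQ (A , c) (h , c≤ , e) =
    from (HasHooks-addCol (updateDiag _∸_ A c) c (b + sum c) γ b)
         (subst (λ A′ → HasHooks A′ γ) (sym (∸-+-diag A c c≤)) h , refl) ,
    trans (prodSuc-diag-addCol (updateDiag _∸_ A c) c (b + sum c))
          (trans (cong (λ D → 1 * prodSuc D * suc (b + sum c)) (diag-updateDiag _∸_ A c)) e)
  gf : ∀ t → Columned t → g (f t) ≡ t
  gf (A , c , x) (h , _) =
    cong₂ (λ A′ x′ → A′ , c , x′) (+-∸-diag A c) (sym (proj₂ (to (HasHooks-addCol A c x γ b) h)))
  fg : ∀ t → Diagonalised t → f (g t) ≡ t
  fg (A , c) (_ , c≤ , _) = cong (_, c) (∸-+-diag A c c≤)
  regroup : Σ (U m × Vec ℕ m) Diagonalised ↔ Σ (U m) (λ A → HasHooks A γ × Columns 1 b (diag A) d)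
  regroup = mk↔ₛ′ (λ ((A , c) , h , c≤ , e) → A , h , c , c≤ , e)
                  (λ (A , h , c , c≤ , e) → (A , c) , h , c≤ , e)
                  (λ _ → refl) (λ _ → refl)

Columns-∷ : ∀ {m} p s x (E : Vec ℕ m) d →
          Columns p s (x ∷ E) d ↔ Σ ℕ (λ z → z ≤ x × Columns (p * suc (x ∸ z)) (s + z) E d)
Columns-∷ p s x E d = mk↔ₛ′
  (λ { ((z ∷ c) , (z≤x ∷ c≤) , e) → z , z≤x , c , c≤ , trans (sym (weight z c)) e })
  (λ { (z , z≤x , c , c≤ , e) → (z ∷ c) , (z≤x ∷ c≤) , trans (weight z c) e })
  (λ { (z , z≤x , c , c≤ , e) → cong (λ e′ → z , z≤x , c , c≤ , e′) (uip _ _) })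
  (λ { ((z ∷ c) , (z≤x ∷ c≤) , e) → cong (λ e′ → (z ∷ c) , (z≤x ∷ c≤) , e′) (uip _ _) })
  where
  weight : ∀ z c → p * (suc (x ∸ z) * prodSuc (zipWith _∸_ E c)) * suc (s + (z + sum c))
                 ≡ p * suc (x ∸ z) * prodSuc (zipWith _∸_ E c) * suc (s + z + sum c)
  weight z c = ring p (suc (x ∸ z)) (prodSuc (zipWith _∸_ E c)) s z (sum c)
    where
    ring : ∀ p y P s z S → p * (y * P) * suc (s + (z + S)) ≡ p * y * P * suc (s + z + S)
    ring = ℕ-Solver.solve-∀

columnCount : ∀ {m} → Vec ℕ m → (p s d : ℕ) → ℕ
columnCount []      p s d = δ (p * suc s) d
columnCount (x ∷ E) p s d = Σ≤ x (λ z → columnCount E (p * suc (x ∸ z)) (s + z) d)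

Columns↔Fin : ∀ {m} (E : Vec ℕ m) p s d → Columns p s E d ↔ Fin (columnCount E p s d)
Columns↔Fin [] p s d = begin
  Columns p s [] d    ↔⟨ emptyColumn ⟩
  (p * suc s ≡ d)   ↔⟨ ≡↔δ (p * suc s) d ⟩
  Fin (δ (p * suc s) d) ∎
  where
  open EquationalReasoning
  normalise : p * 1 * suc (s + 0) ≡ p * suc s
  normalise = cong₂ (λ a b → a * suc b) (*-identityʳ p) (+-identityʳ s)
  emptyColumn : Columns p s [] d ↔ (p * suc s ≡ d)
  emptyColumn = mk↔ₛ′ (λ { ([] , [] , e) → trans (sym normalise) e }) (λ e → [] , [] , trans normalise e)
                      (λ _ → uip _ _) (λ { ([] , [] , e) → cong (λ e′ → [] , [] , e′) (uip _ _) })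
Columns↔Fin (x ∷ E) p s d = ↔-trans (Columns-∷ p s x E d)
  (Σ≤↔ x _ _ (λ z → Columns↔Fin E (p * suc (x ∸ z)) (s + z) d))

prodSuc-sum0 : ∀ {m} (E : Vec ℕ m) → sum E ≡ 0 → prodSuc E ≡ 1
prodSuc-sum0 []       _ = refl
prodSuc-sum0 (zero ∷ E) e = trans (+-identityʳ (prodSuc E)) (prodSuc-sum0 E e)

prodSuc-sum1 : ∀ {m} (E : Vec ℕ m) → sum E ≡ 1 → prodSuc E ≡ 2
prodSuc-sum1 (zero ∷ E)     e = trans (+-identityʳ (prodSuc E)) (prodSuc-sum1 E e)
prodSuc-sum1 (suc zero ∷ E) e = cong (2 *_) (prodSuc-sum0 E (suc-injective e))

-- With nothing on the diagonal the only column is c = 0.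
columnCount-sum0 : ∀ {m} (E : Vec ℕ m) p s d → sum E ≡ 0 → columnCount E p s d ≡ δ (p * suc s) d
columnCount-sum0 []         p s d _ = refl
columnCount-sum0 (zero ∷ E) p s d e = trans (columnCount-sum0 E (p * 1) (s + 0) d e)
  (cong₂ (λ p′ s′ → δ (p′ * suc s′) d) (*-identityʳ p) (+-identityʳ s))

-- With a single 1 on the diagonal the column is 0 or has a single 1 in the same place.
columnCount-sum1 : ∀ {m} (E : Vec ℕ m) p s d → sum E ≡ 1 →
                  columnCount E p s d ≡ δ (p * 2 * suc s) d + δ (p * suc (suc s)) d
columnCount-sum1 (zero ∷ E)     p s d e = trans (columnCount-sum1 E (p * 1) (s + 0) d e)
  (cong₂ (λ p′ s′ → δ (p′ * 2 * suc s′) d + δ (p′ * suc (suc s′)) d) (*-identityʳ p) (+-identityʳ s))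
columnCount-sum1 (suc zero ∷ E) p s d e = cong₂ _+_
  (trans (columnCount-sum0 E (p * 2) (s + 0) d (suc-injective e)) (cong (λ s′ → δ (p * 2 * suc s′) d) (+-identityʳ s)))
  (trans (columnCount-sum0 E (p * 1) (s + 1) d (suc-injective e))
         (cong₂ (λ p′ s′ → δ (p′ * suc s′) d) (*-identityʳ p) (+-comm s 1)))

-- The weight lists 3, 4, 3 and 4, 4, 4, 3 as coefficients of q³ and q⁴.
δ-sum-3 : ∀ d → δ 3 d + (δ 4 d + δ 3 d) ≡ coeff34 2 1 d
δ-sum-3 0 = refl
δ-sum-3 1 = refl
δ-sum-3 2 = refl
δ-sum-3 3 = refl
δ-sum-3 4 = refl
δ-sum-3 (suc (suc (suc (suc (suc d))))) = refl

δ-sum-4 : ∀ d → δ 4 d + δ 4 d + (δ 4 d + δ 3 d) ≡ coeff34 1 3 d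
δ-sum-4 0 = refl
δ-sum-4 1 = refl
δ-sum-4 2 = refl
δ-sum-4 3 = refl
δ-sum-4 4 = refl
δ-sum-4 (suc (suc (suc (suc (suc d))))) = refl

-- A diagonal of trace 2 is either 2·eᵢ, with product 3 and columns of weights 3, 4, 3, or eᵢ + eⱼ,
-- with product 4 and columns of weights 4, 4, 4, 3.
columnCount-sum2 : ∀ {m} (E : Vec ℕ m) d → sum E ≡ 2 →
  (prodSuc E ≡ 3 × columnCount E 1 0 d ≡ coeff34 2 1 d) ⊎ (prodSuc E ≡ 4 × columnCount E 1 0 d ≡ coeff34 1 3 d)
columnCount-sum2 (zero ∷ E) d e with columnCount-sum2 E d e
... | inj₁ (prod , count) = inj₁ (trans (+-identityʳ (prodSuc E)) prod , count)
... | inj₂ (prod , count) = inj₂ (trans (+-identityʳ (prodSuc E)) prod , count)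
columnCount-sum2 (suc zero ∷ E) d e = inj₂ (cong (2 *_) (prodSuc-sum1 E e′) ,
  trans (cong₂ _+_ (columnCount-sum1 E 2 0 d e′) (columnCount-sum1 E 1 1 d e′)) (δ-sum-4 d))
  where
  e′ : sum E ≡ 1
  e′ = suc-injective e
columnCount-sum2 (suc (suc zero) ∷ E) d e = inj₁ (cong (3 *_) (prodSuc-sum0 E e′) ,
  trans (cong₂ _+_ (columnCount-sum0 E 3 0 d e′)
                   (cong₂ _+_ (columnCount-sum0 E 2 1 d e′) (columnCount-sum0 E 1 2 d e′)))
        (δ-sum-3 d))
  where
  e′ : sum E ≡ 0
  e′ = suc-injective (suc-injective e)

β110-∷ʳ : ∀ j → β110 (suc j) ≡ β110 j ∷ʳ 0
β110-∷ʳ j = cong (λ v → 1 ∷ 1 ∷ v) (zeros-∷ʳ j)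
  where
  zeros-∷ʳ : ∀ j → replicate (suc j) 0 ≡ replicate j 0 ∷ʳ 0
  zeros-∷ʳ zero    = refl
  zeros-∷ʳ (suc j) = cong (0 ∷_) (zeros-∷ʳ j)

sum-β110 : ∀ j → sum (β110 j) ≡ 2
sum-β110 j = cong (λ t → 2 + t) (sum-zeros j)
  where
  sum-zeros : ∀ j → sum (replicate j 0) ≡ 0
  sum-zeros zero    = refl
  sum-zeros (suc j) = sum-zeros j

columns-trace2 : ∀ {m} (γ : Vec ℕ m) d → sum γ ≡ 2 → (A : U m) → HasHooks A γ →
  (prodSuc (diag A) ≡ 3 × Columns 1 0 (diag A) d ↔ Fin (coeff34 2 1 d)) ⊎
  (prodSuc (diag A) ≡ 4 × Columns 1 0 (diag A) d ↔ Fin (coeff34 1 3 d))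
columns-trace2 γ d Σγ≡2 A h with columnCount-sum2 (diag A) d (trans (trace≡sum-hooks A γ h) Σγ≡2)
... | inj₁ (prod , count) = inj₁ (prod , ↔-trans (Columns↔Fin (diag A) 1 0 d) (Fin-cong count))
... | inj₂ (prod , count) = inj₂ (prod , ↔-trans (Columns↔Fin (diag A) 1 0 d) (Fin-cong count))

noTerm : ∀ a b → a * 0 + b * 0 ≡ 0
noTerm = ℕ-Solver.solve-∀

coeff34-combine : ∀ a b d → a * coeff34 2 1 d + b * coeff34 1 3 d ≡ coeff34 (2 * a + b) (a + 3 * b) d
coeff34-combine a b 0 = noTerm a b
coeff34-combine a b 1 = noTerm a b
coeff34-combine a b 2 = noTerm a b
coeff34-combine a b 3 = ring a b
  where
  ring : ∀ a b → a * 2 + b * 1 ≡ 2 * a + b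
  ring = ℕ-Solver.solve-∀
coeff34-combine a b 4 = ring a b
  where
  ring : ∀ a b → a * 1 + b * 3 ≡ a + 3 * b
  ring = ℕ-Solver.solve-∀
coeff34-combine a b (suc (suc (suc (suc (suc d))))) = noTerm a b

mainTheorem14 : (j a b : ℕ)
    → TD (2 + j) (β110 j) 3 ↔ Fin a
    → TD (2 + j) (β110 j) 4 ↔ Fin b
    → (d : ℕ) → TD (3 + j) (β110 (suc j)) d ↔ Fin (coeff34 (2 * a + b) (a + 3 * b) d)
mainTheorem14 j a b T₃↔a T₄↔b d = begin
  TD (3 + j) (β110 (suc j)) d                          ↔⟨ TD↔TDʳ (3 + j) (β110 (suc j)) d ⟩
  TDʳ (3 + j) (β110 (suc j)) d                         ≡⟨ cong (λ γ → TDʳ (3 + j) γ d) (β110-∷ʳ j) ⟩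
  TDʳ (3 + j) (β ∷ʳ 0) d                               ↔⟨ lastColumn β 0 d ⟩
  Σ (U (2 + j)) (λ A → HasHooks A β × Columns 1 0 (diag A) d)
       ↔⟨ Σ-split-count (λ A → HasHooks A β) (λ A → Columns 1 0 (diag A) d) (λ A → prodSuc (diag A))
                        (λ ()) (columns-trace2 β d (sum-β110 j)) ⟩
  ((TDʳ (2 + j) β 3 × Fin (coeff34 2 1 d)) ⊎ (TDʳ (2 + j) β 4 × Fin (coeff34 1 3 d)))
       ↔⟨ (Tʳ↔ 3 T₃↔a ×-↔ ↔-refl) ⊎-↔ (Tʳ↔ 4 T₄↔b ×-↔ ↔-refl) ⟩
  ((Fin a × Fin (coeff34 2 1 d)) ⊎ (Fin b × Fin (coeff34 1 3 d)))   ↔⟨ ↔-sym *↔× ⊎-↔ ↔-sym *↔× ⟩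
  (Fin (a * coeff34 2 1 d) ⊎ Fin (b * coeff34 1 3 d))              ↔⟨ ↔-sym +↔⊎ ⟩
  Fin (a * coeff34 2 1 d + b * coeff34 1 3 d)                       ≡⟨ cong Fin (coeff34-combine a b d) ⟩
  Fin (coeff34 (2 * a + b) (a + 3 * b) d)                            ∎
  where
  open EquationalReasoning
  β : Vec ℕ (2 + j)
  β = β110 j
  Tʳ↔ : ∀ k {n} → TD (2 + j) β k ↔ Fin n → TDʳ (2 + j) β k ↔ Fin n
  Tʳ↔ k T↔n = ↔-trans (↔-sym (TD↔TDʳ (2 + j) β k)) T↔n
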